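{- Let $G$ be an undirected graph with $k$ designated disjoint terminal pairs $(s_1,t_1),\dots,(s_k,t_k)$, and let $H$ be the directed graph constructed from $G$ as described in the context. Then all shortest good cycle covers of $H$ have the same sign.
   Context: Construction of $H$: replace each undirected edge $\{u,v\}$ of $G$ by the two arcs $(u,v)$ and $(v,u)$; for each $i\in[k]$ add a new vertex $r_i$ and the arcs $(t_i,r_i)$ and $(r_i,s_i)$ (a subdivided "demand edge" from sink to source); the $3k$ vertices $s_i,t_i,r_i$ are called special; add a self-loop at every non-special vertex. A cycle cover of $H$ is a set of vertex-disjoint directed cycles (self-loops allowed) covering every vertex of $H$; it is identified with a permutation of $V(H)$, and its sign is the sign of this permutation. The length of a cycle cover is the number of its arcs that are not self-loops. A cycle cover is good if each of its cycles that contains a special vertex is of the form $s_i \to P_i \to t_i\to r_i\to s_i$ for some $i$, where $P_i$ is a path in $G$ from $s_i$ to $t_i$ (so it contains exactly one designated terminal pair); i.e. it extends a collection of $k$ vertex-disjoint $s_i$–$t_i$ paths. A shortest good cycle cover is a good cycle cover of minimum length among all good cycle covers. -}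

module Defs where

open import Data.Nat using (ℕ; zero; suc; _+_; _<_; _≤_; _%_)
open import Data.Fin using (Fin; toℕ; splitAt) renaming (_<?_ to _<ᶠ?_)
open import Data.Fin.Properties using (_≟_)
open import Data.Fin.Permutation using (Permutation′; _⟨$⟩ʳ_)
open import Data.List using (List; map; allFin; concatMap)
open import Data.Nat.ListAction using (sum)
open import Data.Sum using (_⊎_; inj₁; inj₂)
open import Data.Product using (Σ; ∃; _×_; _,_)
open import Data.Empty using (⊥)
open import Relation.Nullary using (¬_; does)
open import Relation.Binary.PropositionalEquality using (_≡_)
open import Data.Bool using (if_then_else_; _∧_)

SimpleGraph : ℕ → Set₁
SimpleGraph n = Σ (Fin n → Fin n → Set) λ Adj →
  (∀ u v → Adj u v → Adj v u) × (∀ u → ¬ Adj u u)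

DisjointPairs : (n k : ℕ) → (Fin k → Fin n) → (Fin k → Fin n) → Set
DisjointPairs n k s t =
  (∀ i j → s i ≡ s j → i ≡ j) ×
  (∀ i j → t i ≡ t j → i ≡ j) ×
  (∀ i j → ¬ (s i ≡ t j))

-- The digraph H.  Its vertex set is Fin (n + k): a vertex x with
-- splitAt n x = inj₁ u is the vertex u of G, and one with
-- splitAt n x = inj₂ i is the new vertex r i.

module H (n k : ℕ) (Adj : Fin n → Fin n → Set) (s t : Fin k → Fin n) where

  SpecialG : Fin n → Set
  SpecialG u = ∃ λ i → (u ≡ s i) ⊎ (u ≡ t i)

  Special : Fin (n + k) → Set
  Special x with splitAt n x
  ... | inj₁ u = SpecialG u
  ... | inj₂ _ = Data.Unit.⊤
    where import Data.Unit

  NonSpecial : Fin (n + k) → Set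
  NonSpecial x = ¬ Special x

  data Arc′ : Fin n ⊎ Fin k → Fin n ⊎ Fin k → Set where
    edge : ∀ {u v} → Adj u v → Arc′ (inj₁ u) (inj₁ v)
    t→r  : ∀ {u} i → u ≡ t i → Arc′ (inj₁ u) (inj₂ i)
    r→s  : ∀ {v} i → v ≡ s i → Arc′ (inj₂ i) (inj₁ v)
    loop : ∀ {u} → ¬ SpecialG u → Arc′ (inj₁ u) (inj₁ u)

  Arc : Fin (n + k) → Fin (n + k) → Set
  Arc x y = Arc′ (splitAt n x) (splitAt n y)

  sH tH rH : Fin k → Fin (n + k)
  sH i = s i Data.Fin.↑ˡ k
  tH i = t i Data.Fin.↑ˡ k
  rH i = n Data.Fin.↑ʳ i

  -- a cycle cover of H = a permutation σ of V(H) with (x , σ x) an arc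
  -- of H for every x (σ x ≡ x means x is covered by its self-loop)
  CycleCover : Permutation′ (n + k) → Set
  CycleCover σ = ∀ x → Arc x (σ ⟨$⟩ʳ x)

  iter : Permutation′ (n + k) → ℕ → Fin (n + k) → Fin (n + k)
  iter σ zero    x = x
  iter σ (suc m) x = σ ⟨$⟩ʳ (iter σ m x)

  -- the cycle of σ through s i has the form s i → P i → t i → r i → s i,
  -- where P i is a path in G all of whose inner vertices are non-special
  -- (consecutive vertices of P i are adjacent in G since σ is a cycle
  -- cover and arcs of H between G-vertices are exactly the G-arcs).
  DemandCycle : Permutation′ (n + k) → Fin k → Set
  DemandCycle σ i = Σ ℕ λ m →
    (1 ≤ m) × (iter σ m (sH i) ≡ tH i) ×
    (∀ l → 1 ≤ l → l < m → NonSpecial (iter σ l (sH i))) ×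
    (σ ⟨$⟩ʳ tH i ≡ rH i) × (σ ⟨$⟩ʳ rH i ≡ sH i)

  Good : Permutation′ (n + k) → Set
  Good σ = CycleCover σ ×
    (∀ x → Special x →
      ∃ λ i → (∃ λ l → iter σ l (sH i) ≡ x) × DemandCycle σ i)

  len : Permutation′ (n + k) → ℕ
  len σ = sum (map (λ x → if does (σ ⟨$⟩ʳ x ≟ x) then 0 else 1) (allFin (n + k)))

  ShortestGood : Permutation′ (n + k) → Set
  ShortestGood σ = Good σ × (∀ τ → Good τ → len σ ≤ len τ)

-- Sign of a permutation of Fin N: parity of the number of inversions
-- (0 = even = sign +1, 1 = odd = sign -1).

inversions : ∀ {N} → Permutation′ N → ℕ
inversions {N} σ = sum (concatMap (λ i → map (λ j →
    if does (i <ᶠ? j) ∧ does ((σ ⟨$⟩ʳ j) <ᶠ? (σ ⟨$⟩ʳ i)) then 1 else 0)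
    (allFin N)) (allFin N))

sign : ∀ {N} → Permutation′ N → ℕ
sign σ = inversions σ % 2

-- The parity of the inversion count is a homomorphism on permutations and is odd on
-- transpositions. Composing σ with the transposition of x and σ⁻¹ x splices x out of its
-- cycle, so induction on the number of moved points gives
--   sign σ = (-1) ^ (number of moved points − number of non-trivial cycles).
-- In a shortest good cycle cover every non-trivial cycle contains exactly one source s i:
-- a non-trivial cycle without a source consists of non-special vertices, so replacing it
-- by self-loops would give a shorter good cover. Hence a shortest good cover has exactly k
-- non-trivial cycles, and its sign is determined by its length alone.

module Submission where

open import Defs
open import Data.Nat using (ℕ; _+_)
open import Data.Fin using (Fin)
open import Data.Fin.Permutation using (Permutation′)
open import Data.Product using (_×_; proj₁)
open import Relation.Binary.PropositionalEquality using (_≡_)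

open import Algebra.Bundles using (CommutativeRing)
open import Data.Bool using (Bool; true; false; not; _∧_; _xor_; if_then_else_)
open import Data.Bool.Properties
  using (xor-∧-commutativeRing; xor-identityʳ; not-involutive; not-distribˡ-xor;
         ∧-comm; ∧-zeroʳ; ∧-identityʳ; ∧-inverseʳ; ∧-distribˡ-xor; ∧-distribʳ-xor)
open import Data.Empty using (⊥-elim)
open import Data.Fin as Fin using (zero; suc; punchIn; toℕ; fromℕ<; splitAt)
open import Data.Fin.Permutation
  using (_⟨$⟩ʳ_; _⟨$⟩ˡ_; _∘ₚ_; transpose; permutation; inverseˡ; inverseʳ)
open import Data.Fin.Properties as Fin using (_≟_; _<?_; punchInᵢ≢i)
open import Data.List as List using (List; []; _∷_; tabulate; concatMap)
open import Data.List.Membership.Propositional using (_∈_)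
open import Data.List.Membership.Propositional.Properties using (∈-allFin)
open import Data.List.Relation.Unary.Any using (here; there)
open import Data.Nat as ℕ using (zero; suc; _%_; _/_; _*_; _∸_; _<_; _≤_; z≤n)
open import Data.Nat.DivMod using ([m+n]%n≡m%n; m≡m%n+[m/n]*n; m%n<n)
open import Data.Nat.Induction using (<-wellFounded)
import Data.Nat.ListAction as ListAction
open import Data.Nat.ListAction.Properties using (sum-++)
import Data.Nat.Properties as ℕ
open import Data.Product using (proj₂; ∃; _,_)
open import Data.Sum using (_⊎_; inj₁; inj₂)
open import Data.Unit using (tt)
open import Function using (_∘_)
open import Function.Bundles using (Injection)
open import Function.Properties.Inverse using (Inverse⇒Injection)
open import Induction.WellFounded using (Acc; acc)
open import Relation.Binary.Definitions using (tri<; tri≈; tri>)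
open import Relation.Binary.PropositionalEquality
  using (refl; sym; trans; cong; cong₂; subst; _≢_; module ≡-Reasoning)
open import Relation.Nullary using (Dec; does; yes; no; ¬_)
open import Relation.Nullary.Decidable using (dec-true; dec-false; ¬?; decidable-stable)

-- ∑ is summation in the Boolean ring (xor, ∧): the parity of the number of true terms.
open import Algebra.Properties.Semiring.Sum (CommutativeRing.semiring xor-∧-commutativeRing)
  using (sum; sum-syntax; sum-remove; sum-cong-≗; sum-replicate-zero; ∑-distrib-+; ∑-comm; ∑-permute)

private
  variable
    N : ℕ

isOdd : ℕ → Bool
isOdd zero    = false
isOdd (suc n) = not (isOdd n)

isOdd-+ : ∀ m n → isOdd (m + n) ≡ isOdd m xor isOdd n
isOdd-+ zero    n = refl
isOdd-+ (suc m) n = trans (cong not (isOdd-+ m n)) (not-distribˡ-xor (isOdd m) (isOdd n))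

%2-isOdd : ∀ n → n % 2 ≡ (if isOdd n then 1 else 0)
%2-isOdd zero          = refl
%2-isOdd (suc zero)    = refl
%2-isOdd (suc (suc n)) = begin
  (2 + n) % 2                     ≡⟨ cong (_% 2) (ℕ.+-comm 2 n) ⟩
  (n + 2) % 2                     ≡⟨ [m+n]%n≡m%n n 2 ⟩
  n % 2                           ≡⟨ %2-isOdd n ⟩
  (if isOdd n then 1 else 0)      ≡⟨ cong (if_then 1 else 0) (not-involutive (isOdd n)) ⟨
  (if isOdd (2 + n) then 1 else 0) ∎
  where open ≡-Reasoning

isOdd-if : ∀ b → isOdd (if b then 1 else 0) ≡ b
isOdd-if true  = refl
isOdd-if false = refl

isOdd-sum-map-tabulate : ∀ {A : Set} (h : A → ℕ) (g : Fin N → A) →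
  isOdd (ListAction.sum (List.map h (tabulate g))) ≡ ∑[ i < N ] isOdd (h (g i))
isOdd-sum-map-tabulate {zero}  h g = refl
isOdd-sum-map-tabulate {suc N} h g =
  trans (isOdd-+ (h (g zero)) _) (cong (isOdd (h (g zero)) xor_) (isOdd-sum-map-tabulate h (g ∘ suc)))

isOdd-sum-concatMap-tabulate : ∀ {A : Set} (F : A → List ℕ) (g : Fin N → A) →
  isOdd (ListAction.sum (concatMap F (tabulate g))) ≡ ∑[ i < N ] isOdd (ListAction.sum (F (g i)))
isOdd-sum-concatMap-tabulate {zero}  F g = refl
isOdd-sum-concatMap-tabulate {suc N} F g = begin
  isOdd (ListAction.sum (F (g zero) List.++ rest))
    ≡⟨ cong isOdd (sum-++ (F (g zero)) rest) ⟩
  isOdd (ListAction.sum (F (g zero)) + ListAction.sum rest)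
    ≡⟨ isOdd-+ (ListAction.sum (F (g zero))) _ ⟩
  isOdd (ListAction.sum (F (g zero))) xor isOdd (ListAction.sum rest)
    ≡⟨ cong (isOdd (ListAction.sum (F (g zero))) xor_) (isOdd-sum-concatMap-tabulate F (g ∘ suc)) ⟩
  isOdd (ListAction.sum (F (g zero))) xor ∑[ i < N ] isOdd (ListAction.sum (F (g (suc i))))
    ∎
  where
  open ≡-Reasoning
  rest : List ℕ
  rest = concatMap F (tabulate (g ∘ suc))

∑-false : (f : Fin N → Bool) → (∀ i → f i ≡ false) → ∑[ i < N ] f i ≡ false
∑-false {N} f f≡false = trans (sum-cong-≗ f≡false) (sum-replicate-zero N)

∑-point : (f : Fin N → Bool) (p : Fin N) → (∀ i → i ≢ p → f i ≡ false) → ∑[ i < N ] f i ≡ f p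
∑-point {suc N} f p off = begin
  sum f                                    ≡⟨ sum-remove f ⟩
  f p xor ∑[ i < N ] f (punchIn p i)       ≡⟨ cong (f p xor_) (∑-false _ (λ i → off _ (punchInᵢ≢i p i))) ⟩
  f p xor false                            ≡⟨ xor-identityʳ (f p) ⟩
  f p                                      ∎
  where open ≡-Reasoning

∑-agree-off : (f g : Fin N → Bool) (p : Fin N) → (∀ i → i ≢ p → f i ≡ g i) →
  ∑[ i < N ] f i ≡ (f p xor g p) xor ∑[ i < N ] g i
∑-agree-off {suc N} f g p agree = begin
  sum f                                                ≡⟨ sum-remove f ⟩
  f p xor ∑[ i < N ] f (punchIn p i)                   ≡⟨ cong (f p xor_) (sum-cong-≗ (λ i → agree _ (punchInᵢ≢i p i))) ⟩
  f p xor ∑[ i < N ] g (punchIn p i)                   ≡⟨ xor-insert (f p) (g p) _ ⟩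
  (f p xor g p) xor (g p xor ∑[ i < N ] g (punchIn p i)) ≡⟨ cong ((f p xor g p) xor_) (sum-remove g) ⟨
  (f p xor g p) xor sum g                              ∎
  where
  open ≡-Reasoning
  xor-insert : ∀ x y z → x xor z ≡ (x xor y) xor (y xor z)
  xor-insert false false z     = refl
  xor-insert false true  false = refl
  xor-insert false true  true  = refl
  xor-insert true  false z     = refl
  xor-insert true  true  false = refl
  xor-insert true  true  true  = refl

∑∑-distrib-xor : (f g : Fin N → Fin N → Bool) →
  ∑[ i < N ] ∑[ j < N ] (f i j xor g i j) ≡ (∑[ i < N ] ∑[ j < N ] f i j) xor (∑[ i < N ] ∑[ j < N ] g i j)
∑∑-distrib-xor f g =
  trans (sum-cong-≗ (λ i → ∑-distrib-+ (f i) (g i))) (∑-distrib-+ (λ i → sum (f i)) (λ i → sum (g i)))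

_<ᵇ_ : Fin N → Fin N → Bool
i <ᵇ j = does (i <? j)

<ᵇ-irrefl : (i : Fin N) → i <ᵇ i ≡ false
<ᵇ-irrefl i = dec-false (i <? i) (Fin.<-irrefl refl)

<ᵇ-flip : {i j : Fin N} → i ≢ j → j <ᵇ i ≡ not (i <ᵇ j)
<ᵇ-flip {i = i} {j} i≢j with Fin.<-cmp i j
... | tri< i<j _ j≮i = trans (dec-false (j <? i) j≮i) (cong not (sym (dec-true (i <? j) i<j)))
... | tri≈ _ i≡j _   = ⊥-elim (i≢j i≡j)
... | tri> i≮j _ j<i = trans (dec-true (j <? i) j<i) (cong not (sym (dec-false (i <? j) i≮j)))

⟨$⟩ʳ-injective : (π : Permutation′ N) {x y : Fin N} → π ⟨$⟩ʳ x ≡ π ⟨$⟩ʳ y → x ≡ y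
⟨$⟩ʳ-injective π = Injection.injective (Inverse⇒Injection π)

<ᵇ-asym : (i j : Fin N) → i <ᵇ j ∧ j <ᵇ i ≡ false
<ᵇ-asym i j with i ≟ j
... | yes refl rewrite <ᵇ-irrefl i = refl
... | no i≢j   rewrite <ᵇ-flip i≢j = ∧-inverseʳ (i <ᵇ j)

inversionParity : Permutation′ N → Bool
inversionParity {N} π = ∑[ i < N ] ∑[ j < N ] (i <ᵇ j ∧ (π ⟨$⟩ʳ j) <ᵇ (π ⟨$⟩ʳ i))

isOdd-inversions : (π : Permutation′ N) → isOdd (inversions π) ≡ inversionParity π
isOdd-inversions {N} π =
  trans (isOdd-sum-concatMap-tabulate row (λ i → i))
        (sum-cong-≗ λ i → trans (isOdd-sum-map-tabulate (entry i) (λ j → j)) (sum-cong-≗ {N} λ j → isOdd-if _))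
  where
  entry : Fin N → Fin N → ℕ
  entry i j = if i <ᵇ j ∧ (π ⟨$⟩ʳ j) <ᵇ (π ⟨$⟩ʳ i) then 1 else 0
  row : Fin N → List ℕ
  row i = List.map (entry i) (List.allFin N)

∑∑-split-< : (h : Fin N → Fin N → Bool) → (∀ i → h i i ≡ false) →
  ∑[ i < N ] ∑[ j < N ] h i j ≡ ∑[ i < N ] ∑[ j < N ] (i <ᵇ j ∧ (h i j xor h j i))
∑∑-split-< {N} h h-diag = begin
  ∑[ i < N ] ∑[ j < N ] h i j
    ≡⟨ sum-cong-≗ (λ i → sum-cong-≗ (split i)) ⟩
  ∑[ i < N ] ∑[ j < N ] ((i <ᵇ j ∧ h i j) xor (j <ᵇ i ∧ h i j))
    ≡⟨ ∑∑-distrib-xor (λ i j → i <ᵇ j ∧ h i j) (λ i j → j <ᵇ i ∧ h i j) ⟩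
  (∑[ i < N ] ∑[ j < N ] (i <ᵇ j ∧ h i j)) xor (∑[ i < N ] ∑[ j < N ] (j <ᵇ i ∧ h i j))
    ≡⟨ cong (∑[ i < N ] ∑[ j < N ] (i <ᵇ j ∧ h i j) xor_) (∑-comm (λ i j → j <ᵇ i ∧ h i j)) ⟩
  (∑[ i < N ] ∑[ j < N ] (i <ᵇ j ∧ h i j)) xor (∑[ i < N ] ∑[ j < N ] (i <ᵇ j ∧ h j i))
    ≡⟨ ∑∑-distrib-xor (λ i j → i <ᵇ j ∧ h i j) (λ i j → i <ᵇ j ∧ h j i) ⟨
  ∑[ i < N ] ∑[ j < N ] ((i <ᵇ j ∧ h i j) xor (i <ᵇ j ∧ h j i))
    ≡⟨ sum-cong-≗ (λ i → sum-cong-≗ (λ j → ∧-distribˡ-xor (i <ᵇ j) (h i j) (h j i))) ⟨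
  ∑[ i < N ] ∑[ j < N ] (i <ᵇ j ∧ (h i j xor h j i))
    ∎
  where
  open ≡-Reasoning
  by-flip : ∀ a x → x ≡ (a ∧ x) xor (not a ∧ x)
  by-flip true  x = sym (xor-identityʳ x)
  by-flip false x = refl
  split : ∀ i j → h i j ≡ (i <ᵇ j ∧ h i j) xor (j <ᵇ i ∧ h i j)
  split i j with i ≟ j
  ... | yes refl rewrite <ᵇ-irrefl i | h-diag i = refl
  ... | no i≢j rewrite <ᵇ-flip i≢j = by-flip (i <ᵇ j) (h i j)

inversionParity-∘ₚ : (ρ π : Permutation′ N) →
  inversionParity (ρ ∘ₚ π) ≡ inversionParity ρ xor inversionParity π
inversionParity-∘ₚ {N} ρ π = trans (xor-cancelʳ _ (inversionParity π)) (cong (_xor inversionParity π) difference)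
  where
  open ≡-Reasoning
  r g : Fin N → Fin N
  r x = ρ ⟨$⟩ʳ x
  g x = π ⟨$⟩ʳ (r x)

  xor-cancelʳ : ∀ x p → x ≡ (x xor p) xor p
  xor-cancelʳ false false = refl
  xor-cancelʳ false true  = refl
  xor-cancelʳ true  false = refl
  xor-cancelʳ true  true  = refl

  relabel : inversionParity π ≡ ∑[ i < N ] ∑[ j < N ] (r i <ᵇ r j ∧ g j <ᵇ g i)
  relabel = trans (∑-permute _ ρ) (sum-cong-≗ λ i → ∑-permute (λ j → r i <ᵇ j ∧ (π ⟨$⟩ʳ j) <ᵇ g i) ρ)

  reversed : Fin N → Fin N → Bool
  reversed i j = i <ᵇ j xor r i <ᵇ r j

  ordered-pair : ∀ a b c → a ∧ ((a xor b) ∧ c xor (not a xor not b) ∧ not c) ≡ a ∧ not b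
  ordered-pair false b     c     = refl
  ordered-pair true  true  c     = refl
  ordered-pair true  false true  = refl
  ordered-pair true  false false = refl

  pair : ∀ i j → i <ᵇ j ∧ (reversed i j ∧ g j <ᵇ g i xor reversed j i ∧ g i <ᵇ g j) ≡ i <ᵇ j ∧ r j <ᵇ r i
  pair i j with i ≟ j
  ... | yes refl rewrite <ᵇ-irrefl i = refl
  ... | no i≢j
    rewrite <ᵇ-flip i≢j
          | <ᵇ-flip {i = r i} (i≢j ∘ ⟨$⟩ʳ-injective ρ)
          | <ᵇ-flip {i = g j} (i≢j ∘ sym ∘ ⟨$⟩ʳ-injective ρ ∘ ⟨$⟩ʳ-injective π)
    = ordered-pair (i <ᵇ j) (r i <ᵇ r j) (g j <ᵇ g i)

  difference : inversionParity (ρ ∘ₚ π) xor inversionParity π ≡ inversionParity ρ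
  difference = begin
    inversionParity (ρ ∘ₚ π) xor inversionParity π
      ≡⟨ cong (inversionParity (ρ ∘ₚ π) xor_) relabel ⟩
    (∑[ i < N ] ∑[ j < N ] (i <ᵇ j ∧ g j <ᵇ g i)) xor (∑[ i < N ] ∑[ j < N ] (r i <ᵇ r j ∧ g j <ᵇ g i))
      ≡⟨ ∑∑-distrib-xor (λ i j → i <ᵇ j ∧ g j <ᵇ g i) (λ i j → r i <ᵇ r j ∧ g j <ᵇ g i) ⟨
    ∑[ i < N ] ∑[ j < N ] ((i <ᵇ j ∧ g j <ᵇ g i) xor (r i <ᵇ r j ∧ g j <ᵇ g i))
      ≡⟨ sum-cong-≗ (λ i → sum-cong-≗ (λ j → ∧-distribʳ-xor (g j <ᵇ g i) (i <ᵇ j) (r i <ᵇ r j))) ⟨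
    ∑[ i < N ] ∑[ j < N ] (reversed i j ∧ g j <ᵇ g i)
      ≡⟨ ∑∑-split-< (λ i j → reversed i j ∧ g j <ᵇ g i) (λ i → cong₂ (λ u v → (u xor v) ∧ g i <ᵇ g i) (<ᵇ-irrefl i) (<ᵇ-irrefl (r i))) ⟩
    ∑[ i < N ] ∑[ j < N ] (i <ᵇ j ∧ (reversed i j ∧ g j <ᵇ g i xor reversed j i ∧ g i <ᵇ g j))
      ≡⟨ sum-cong-≗ (λ i → sum-cong-≗ (pair i)) ⟩
    inversionParity ρ
      ∎

inversionParity-cong : {π ρ : Permutation′ N} → (∀ x → π ⟨$⟩ʳ x ≡ ρ ⟨$⟩ʳ x) → inversionParity π ≡ inversionParity ρ
inversionParity-cong π≗ρ = sum-cong-≗ λ i → sum-cong-≗ λ j → cong₂ (λ u v → i <ᵇ j ∧ u <ᵇ v) (π≗ρ j) (π≗ρ i)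

transpose-appˡ : (a b : Fin N) → transpose a b ⟨$⟩ʳ a ≡ b
transpose-appˡ a b rewrite dec-true (a ≟ a) refl = refl

transpose-appʳ : (a b : Fin N) → transpose a b ⟨$⟩ʳ b ≡ a
transpose-appʳ a b with b ≟ a
... | yes b≡a = b≡a
... | no _ rewrite dec-true (b ≟ b) refl = refl

transpose-app-other : (a b : Fin N) {k : Fin N} → k ≢ a → k ≢ b → transpose a b ⟨$⟩ʳ k ≡ k
transpose-app-other a b {k} k≢a k≢b rewrite dec-false (k ≟ a) k≢a | dec-false (k ≟ b) k≢b = refl

transpose-comm : (a b k : Fin N) → transpose a b ⟨$⟩ʳ k ≡ transpose b a ⟨$⟩ʳ k
transpose-comm a b k = by-cases (k ≟ a) (k ≟ b)
  where
  by-cases : Dec (k ≡ a) → Dec (k ≡ b) → transpose a b ⟨$⟩ʳ k ≡ transpose b a ⟨$⟩ʳ k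
  by-cases (yes refl) _          = trans (transpose-appˡ k b) (sym (transpose-appʳ b k))
  by-cases (no _)     (yes refl) = trans (transpose-appʳ a k) (sym (transpose-appˡ k a))
  by-cases (no k≢a)   (no k≢b)   = trans (transpose-app-other a b k≢a k≢b) (sym (transpose-app-other b a k≢b k≢a))

module _ {a b : Fin N} (a<b : a Fin.< b) where
  private
    τ : Fin N → Fin N
    τ k = transpose a b ⟨$⟩ʳ k

    row : Fin N → Bool
    row i = ∑[ j < N ] (i <ᵇ j ∧ τ j <ᵇ τ i)

    between : Fin N → Bool
    between c = a <ᵇ c ∧ c <ᵇ b

    a<ᵇb : a <ᵇ b ≡ true
    a<ᵇb = dec-true (a <? b) a<b

    nothing-in-b-a : ∀ j → b <ᵇ j ∧ j <ᵇ a ≡ false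
    nothing-in-b-a j = by-cases (b <? j)
      where
      by-cases : Dec (b Fin.< j) → b <ᵇ j ∧ j <ᵇ a ≡ false
      by-cases (yes b<j) rewrite dec-false (j <? a) (λ j<a → Fin.<-asym a<b (Fin.<-trans b<j j<a)) = ∧-zeroʳ (b <ᵇ j)
      by-cases (no b≮j)  rewrite dec-false (b <? j) b≮j = refl

    between-b : between b ≡ false
    between-b rewrite <ᵇ-irrefl b = ∧-zeroʳ (a <ᵇ b)

    row-a : row a ≡ not (∑[ c < N ] between c)
    row-a rewrite transpose-appˡ a b =
      trans (∑-agree-off _ between b off-b) (cong (_xor ∑[ c < N ] between c) at-b)
      where
      at-b : (a <ᵇ b ∧ τ b <ᵇ b) xor between b ≡ true
      at-b rewrite transpose-appʳ a b | <ᵇ-irrefl b | a<ᵇb = refl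
      off-b : ∀ j → j ≢ b → a <ᵇ j ∧ τ j <ᵇ b ≡ between j
      off-b j j≢b = by-cases (j ≟ a)
        where
        by-cases : Dec (j ≡ a) → a <ᵇ j ∧ τ j <ᵇ b ≡ between j
        by-cases (yes refl) rewrite <ᵇ-irrefl j = refl
        by-cases (no j≢a)   rewrite transpose-app-other a b j≢a j≢b = refl

    row-b : row b ≡ false
    row-b rewrite transpose-appʳ a b = ∑-false _ (λ j → by-cases j (j ≟ a) (j ≟ b))
      where
      by-cases : ∀ j → Dec (j ≡ a) → Dec (j ≡ b) → b <ᵇ j ∧ τ j <ᵇ a ≡ false
      by-cases j (yes refl) _ rewrite dec-false (b <? j) (Fin.<-asym a<b) = refl
      by-cases j (no _) (yes refl) rewrite <ᵇ-irrefl j = refl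
      by-cases j (no j≢a) (no j≢b) rewrite transpose-app-other a b j≢a j≢b = nothing-in-b-a j

    row-other : ∀ i → i ≢ a → i ≢ b → row i ≡ between i
    row-other i i≢a i≢b rewrite transpose-app-other a b i≢a i≢b = trans (∑-point _ b off-b) at-b
      where
      at-b : i <ᵇ b ∧ τ b <ᵇ i ≡ between i
      at-b rewrite transpose-appʳ a b = ∧-comm (i <ᵇ b) (a <ᵇ i)
      off-b : ∀ j → j ≢ b → i <ᵇ j ∧ τ j <ᵇ i ≡ false
      off-b j j≢b = by-cases (j ≟ a)
        where
        by-cases : Dec (j ≡ a) → i <ᵇ j ∧ τ j <ᵇ i ≡ false
        by-cases (yes refl) rewrite transpose-appˡ j b = trans (∧-comm (i <ᵇ j) (b <ᵇ i)) (nothing-in-b-a i)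
        by-cases (no j≢a)   rewrite transpose-app-other a b j≢a j≢b = <ᵇ-asym i j

    row-off-a : ∀ i → i ≢ a → row i ≡ between i
    row-off-a i i≢a = by-cases (i ≟ b)
      where
      by-cases : Dec (i ≡ b) → row i ≡ between i
      by-cases (yes refl) = trans row-b (sym between-b)
      by-cases (no i≢b)   = row-other i i≢a i≢b

  transposition-odd : inversionParity (transpose a b) ≡ true
  transposition-odd = begin
    ∑[ i < N ] row i                                       ≡⟨ ∑-agree-off row between a row-off-a ⟩
    (row a xor between a) xor ∑[ c < N ] between c         ≡⟨ cong₂ (λ u v → (u xor (v ∧ a <ᵇ b)) xor ∑[ c < N ] between c) row-a (<ᵇ-irrefl a) ⟩
    (not (∑[ c < N ] between c) xor false) xor ∑[ c < N ] between c ≡⟨ not-xor-self (∑[ c < N ] between c) ⟩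
    true                                                   ∎
    where
    open ≡-Reasoning
    not-xor-self : ∀ x → (not x xor false) xor x ≡ true
    not-xor-self true  = refl
    not-xor-self false = refl

inversionParity-transpose : (a b : Fin N) → a ≢ b → inversionParity (transpose a b) ≡ true
inversionParity-transpose a b a≢b with Fin.<-cmp a b
... | tri< a<b _ _ = transposition-odd a<b
... | tri≈ _ a≡b _ = ⊥-elim (a≢b a≡b)
... | tri> _ _ b<a = trans (inversionParity-cong {π = transpose a b} {ρ = transpose b a} (transpose-comm a b)) (transposition-odd b<a)

iterate : Permutation′ N → ℕ → Fin N → Fin N
iterate σ zero    x = x
iterate σ (suc l) x = σ ⟨$⟩ʳ iterate σ l x

SameCycle : Permutation′ N → Fin N → Fin N → Set
SameCycle σ x y = ∃ λ l → iterate σ l x ≡ y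

module _ (σ : Permutation′ N) where

  iterate-+ : ∀ l m x → iterate σ (l + m) x ≡ iterate σ l (iterate σ m x)
  iterate-+ zero    m x = refl
  iterate-+ (suc l) m x = cong (σ ⟨$⟩ʳ_) (iterate-+ l m x)

  iterate-sucʳ : ∀ l x → iterate σ (suc l) x ≡ iterate σ l (σ ⟨$⟩ʳ x)
  iterate-sucʳ l x = trans (cong (λ t → iterate σ t x) (ℕ.+-comm 1 l)) (iterate-+ l 1 x)

  iterate-injective : ∀ l {x y} → iterate σ l x ≡ iterate σ l y → x ≡ y
  iterate-injective zero    e = e
  iterate-injective (suc l) e = iterate-injective l (⟨$⟩ʳ-injective σ e)

  iterate-fixed : ∀ {x} → σ ⟨$⟩ʳ x ≡ x → ∀ l → iterate σ l x ≡ x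
  iterate-fixed σx≡x zero    = refl
  iterate-fixed σx≡x (suc l) = trans (cong (σ ⟨$⟩ʳ_) (iterate-fixed σx≡x l)) σx≡x

  iterate-period : ∀ x → ∃ λ p → iterate σ (suc p) x ≡ x
  iterate-period x with Fin.pigeonhole (ℕ.n<1+n N) (λ (l : Fin (suc N)) → iterate σ (toℕ l) x)
  ... | i , j , i<j , eq = positive (toℕ j ∸ toℕ i) (ℕ.m<n⇒0<n∸m i<j) (iterate-injective (toℕ i) shifted)
    where
    shifted : iterate σ (toℕ i) (iterate σ (toℕ j ∸ toℕ i) x) ≡ iterate σ (toℕ i) x
    shifted = trans (sym (iterate-+ (toℕ i) _ x))
                    (trans (cong (λ t → iterate σ t x) (ℕ.m+[n∸m]≡n (ℕ.<⇒≤ i<j))) (sym eq))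
    positive : ∀ d → 0 < d → iterate σ d x ≡ x → ∃ λ p → iterate σ (suc p) x ≡ x
    positive (suc p) _ e = p , e

  iterate-multiple : ∀ {p x} → iterate σ p x ≡ x → ∀ q → iterate σ (q * p) x ≡ x
  iterate-multiple e zero            = refl
  iterate-multiple {p} {x} e (suc q) =
    trans (iterate-+ p (q * p) x) (trans (cong (iterate σ p) (iterate-multiple e q)) e)

  iterate-mod : ∀ {p x} → iterate σ (suc p) x ≡ x → ∀ l → iterate σ (l % suc p) x ≡ iterate σ l x
  iterate-mod {p} {x} e l = begin
    iterate σ (l % suc p) x                                     ≡⟨ cong (iterate σ (l % suc p)) (iterate-multiple e (l / suc p)) ⟨
    iterate σ (l % suc p) (iterate σ (l / suc p * suc p) x)     ≡⟨ iterate-+ (l % suc p) _ x ⟨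
    iterate σ (l % suc p + l / suc p * suc p) x                 ≡⟨ cong (λ t → iterate σ t x) (m≡m%n+[m/n]*n l (suc p)) ⟨
    iterate σ l x                                               ∎
    where open ≡-Reasoning

  SameCycle-refl : ∀ x → SameCycle σ x x
  SameCycle-refl x = 0 , refl

  SameCycle-step : ∀ x → SameCycle σ x (σ ⟨$⟩ʳ x)
  SameCycle-step x = 1 , refl

  SameCycle-trans : ∀ {x y z} → SameCycle σ x y → SameCycle σ y z → SameCycle σ x z
  SameCycle-trans {x} (l , refl) (m , refl) = m + l , iterate-+ m l x

  SameCycle-sym : ∀ {x y} → SameCycle σ x y → SameCycle σ y x
  SameCycle-sym {x} (l , refl) with iterate-period x
  ... | p , e = l * p , (begin
    iterate σ (l * p) (iterate σ l x)   ≡⟨ iterate-+ (l * p) l x ⟨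
    iterate σ (l * p + l) x             ≡⟨ cong (λ t → iterate σ t x) (trans (ℕ.+-comm (l * p) l) (sym (ℕ.*-suc l p))) ⟩
    iterate σ (l * suc p) x             ≡⟨ iterate-multiple e l ⟩
    x                                   ∎)
    where open ≡-Reasoning

  SameCycle-stepˡ : ∀ x → SameCycle σ x (σ ⟨$⟩ˡ x)
  SameCycle-stepˡ x = SameCycle-sym (1 , inverseʳ σ)

  sameCycle? : ∀ x y → Dec (SameCycle σ x y)
  sameCycle? x y with iterate-period x
  ... | p , e with Fin.any? (λ (l : Fin (suc p)) → iterate σ (toℕ l) x ≟ y)
  ...   | yes (l , eq) = yes (toℕ l , eq)
  ...   | no none      = no λ where
          (l , eq) → none (fromℕ< (m%n<n l (suc p)) ,
                           trans (cong (λ t → iterate σ t x) (Fin.toℕ-fromℕ< (m%n<n l (suc p))))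
                                 (trans (iterate-mod e l) eq))

-- Definitionally the length H.len of a cycle cover.
moved : Permutation′ N → ℕ
moved {N} σ = ListAction.sum (List.map (λ x → if does (σ ⟨$⟩ʳ x ≟ x) then 0 else 1) (List.allFin N))

isMoved : Permutation′ N → Fin N → Bool
isMoved σ x = not (does (σ ⟨$⟩ʳ x ≟ x))

isMoved-true : (σ : Permutation′ N) {z : Fin N} → σ ⟨$⟩ʳ z ≢ z → isMoved σ z ≡ true
isMoved-true σ {z} σz≢z = cong not (dec-false (σ ⟨$⟩ʳ z ≟ z) σz≢z)

isMoved-false : (σ : Permutation′ N) {z : Fin N} → σ ⟨$⟩ʳ z ≡ z → isMoved σ z ≡ false
isMoved-false σ {z} σz≡z = cong not (dec-true (σ ⟨$⟩ʳ z ≟ z) σz≡z)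

isMoved-cong : (σ ρ : Permutation′ N) {z : Fin N} → σ ⟨$⟩ʳ z ≡ ρ ⟨$⟩ʳ z → isMoved σ z ≡ isMoved ρ z
isMoved-cong σ ρ {z} eq = cong (λ t → not (does (t ≟ z))) eq

isOdd-moved : (σ : Permutation′ N) → isOdd (moved σ) ≡ ∑[ x < N ] isMoved σ x
isOdd-moved {N} σ = trans (isOdd-sum-map-tabulate (λ x → if does (σ ⟨$⟩ʳ x ≟ x) then 0 else 1) (λ x → x)) (sum-cong-≗ {N} λ x → isOdd-if-not (does (σ ⟨$⟩ʳ x ≟ x)))
  where
  isOdd-if-not : ∀ b → isOdd (if b then 0 else 1) ≡ not b
  isOdd-if-not true  = refl
  isOdd-if-not false = refl

sum-map-mono : {A : Set} {f g : A → ℕ} (xs : List A) → (∀ z → f z ≤ g z) →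
  ListAction.sum (List.map f xs) ≤ ListAction.sum (List.map g xs)
sum-map-mono []       f≤g = z≤n
sum-map-mono (x ∷ xs) f≤g = ℕ.+-mono-≤ (f≤g x) (sum-map-mono xs f≤g)

sum-map-mono-< : {A : Set} {f g : A → ℕ} {xs : List A} {p : A} → (∀ z → f z ≤ g z) → p ∈ xs → f p < g p →
  ListAction.sum (List.map f xs) < ListAction.sum (List.map g xs)
sum-map-mono-< {xs = _ ∷ xs} f≤g (here refl) fp<gp = ℕ.+-mono-<-≤ fp<gp (sum-map-mono xs f≤g)
sum-map-mono-< {xs = x ∷ _}  f≤g (there p∈xs) fp<gp = ℕ.+-mono-≤-< (f≤g x) (sum-map-mono-< f≤g p∈xs fp<gp)

moved-< : {σ ρ : Permutation′ N} (x : Fin N) → (∀ z → σ ⟨$⟩ʳ z ≡ z → ρ ⟨$⟩ʳ z ≡ z) →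
  ρ ⟨$⟩ʳ x ≡ x → σ ⟨$⟩ʳ x ≢ x → moved ρ < moved σ
moved-< {σ = σ} {ρ} x fixes ρx≡x σx≢x = sum-map-mono-< (λ z → pointwise z (σ ⟨$⟩ʳ z ≟ z)) (∈-allFin x) at-x
  where
  count : Permutation′ _ → Fin _ → ℕ
  count π z = if does (π ⟨$⟩ʳ z ≟ z) then 0 else 1
  pointwise : ∀ z → Dec (σ ⟨$⟩ʳ z ≡ z) → count ρ z ≤ count σ z
  pointwise z (yes σz≡z) rewrite dec-true (ρ ⟨$⟩ʳ z ≟ z) (fixes z σz≡z) = z≤n
  pointwise z (no σz≢z) rewrite dec-false (σ ⟨$⟩ʳ z ≟ z) σz≢z with does (ρ ⟨$⟩ʳ z ≟ z)
  ... | true  = z≤n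
  ... | false = ℕ.≤-refl
  at-x : count ρ x < count σ x
  at-x rewrite dec-true (ρ ⟨$⟩ʳ x ≟ x) ρx≡x | dec-false (σ ⟨$⟩ʳ x ≟ x) σx≢x = ℕ.≤-refl

module _ (σ : Permutation′ N) (x : Fin N) where
  private
    OffCycle : Fin N → Set
    OffCycle z = ¬ SameCycle σ x z

    off-step : ∀ {z} → OffCycle z → OffCycle (σ ⟨$⟩ʳ z)
    off-step ¬xz xσz = ¬xz (subst (SameCycle σ x) (inverseˡ σ) (SameCycle-trans σ xσz (SameCycle-stepˡ σ _)))

    off-stepˡ : ∀ {z} → OffCycle z → OffCycle (σ ⟨$⟩ˡ z)
    off-stepˡ ¬xz xσz = ¬xz (subst (SameCycle σ x) (inverseʳ σ) (SameCycle-trans σ xσz (SameCycle-step σ _)))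

    off-cycle : (Fin N → Fin N) → Fin N → Fin N
    off-cycle f z = if does (sameCycle? σ x z) then z else f z

    off-cycle-on : ∀ f {z} → SameCycle σ x z → off-cycle f z ≡ z
    off-cycle-on f {z} xz = cong (if_then z else f z) (dec-true (sameCycle? σ x z) xz)

    off-cycle-off : ∀ f {z} → OffCycle z → off-cycle f z ≡ f z
    off-cycle-off f {z} ¬xz = cong (if_then z else f z) (dec-false (sameCycle? σ x z) ¬xz)

    off-cycle-inverse : ∀ f g → (∀ z → f (g z) ≡ z) → (∀ {z} → OffCycle z → OffCycle (g z)) →
      ∀ z → off-cycle f (off-cycle g z) ≡ z
    off-cycle-inverse f g fg g-off z = by-cases (sameCycle? σ x z)
      where
      by-cases : Dec (SameCycle σ x z) → off-cycle f (off-cycle g z) ≡ z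
      by-cases (yes xz) = trans (cong (off-cycle f) (off-cycle-on g xz)) (off-cycle-on f xz)
      by-cases (no ¬xz) = trans (cong (off-cycle f) (off-cycle-off g ¬xz)) (trans (off-cycle-off f (g-off ¬xz)) (fg z))

  fixCycle : Permutation′ N
  fixCycle = permutation (off-cycle (σ ⟨$⟩ʳ_)) (off-cycle (σ ⟨$⟩ˡ_))
    (off-cycle-inverse (σ ⟨$⟩ʳ_) (σ ⟨$⟩ˡ_) (λ _ → inverseʳ σ) off-stepˡ)
    (off-cycle-inverse (σ ⟨$⟩ˡ_) (σ ⟨$⟩ʳ_) (λ _ → inverseˡ σ) off-step)

  fixCycle-on : ∀ {z} → SameCycle σ x z → fixCycle ⟨$⟩ʳ z ≡ z
  fixCycle-on = off-cycle-on (σ ⟨$⟩ʳ_)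

  fixCycle-off : ∀ {z} → ¬ SameCycle σ x z → fixCycle ⟨$⟩ʳ z ≡ σ ⟨$⟩ʳ z
  fixCycle-off = off-cycle-off (σ ⟨$⟩ʳ_)

  iterate-fixCycle : ∀ {z} → ¬ SameCycle σ x z → ∀ l → iterate fixCycle l z ≡ iterate σ l z
  iterate-fixCycle ¬xz zero    = refl
  iterate-fixCycle {z} ¬xz (suc l) = trans (cong (fixCycle ⟨$⟩ʳ_) (iterate-fixCycle ¬xz l)) (fixCycle-off off)
    where
    off : ¬ SameCycle σ x (iterate σ l z)
    off x∼σˡz = ¬xz (SameCycle-trans σ x∼σˡz (SameCycle-sym σ (l , refl)))

  moved-fixCycle : σ ⟨$⟩ʳ x ≢ x → moved fixCycle < moved σ
  moved-fixCycle = moved-< {σ = σ} {ρ = fixCycle} x fixes (fixCycle-on (SameCycle-refl σ x))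
    where
    fixes : ∀ z → σ ⟨$⟩ʳ z ≡ z → fixCycle ⟨$⟩ʳ z ≡ z
    fixes z σz≡z = by-cases (sameCycle? σ x z)
      where
      by-cases : Dec (SameCycle σ x z) → fixCycle ⟨$⟩ʳ z ≡ z
      by-cases (yes xz) = fixCycle-on xz
      by-cases (no ¬xz) = trans (fixCycle-off ¬xz) σz≡z

module _ (σ : Permutation′ N) (x : Fin N) where

  detach : Permutation′ N
  detach = transpose x (σ ⟨$⟩ˡ x) ∘ₚ σ

  detach-fixes : detach ⟨$⟩ʳ x ≡ x
  detach-fixes = trans (cong (σ ⟨$⟩ʳ_) (transpose-appˡ x (σ ⟨$⟩ˡ x))) (inverseʳ σ)

  detach-pred : detach ⟨$⟩ʳ (σ ⟨$⟩ˡ x) ≡ σ ⟨$⟩ʳ x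
  detach-pred = cong (σ ⟨$⟩ʳ_) (transpose-appʳ x (σ ⟨$⟩ˡ x))

  detach-other : ∀ {z} → z ≢ x → z ≢ σ ⟨$⟩ˡ x → detach ⟨$⟩ʳ z ≡ σ ⟨$⟩ʳ z
  detach-other z≢x z≢w = cong (σ ⟨$⟩ʳ_) (transpose-app-other x (σ ⟨$⟩ˡ x) z≢x z≢w)

  detach-step-SameCycle : ∀ z → SameCycle σ z (detach ⟨$⟩ʳ z)
  detach-step-SameCycle z = by-cases (z ≟ x) (z ≟ σ ⟨$⟩ˡ x)
    where
    by-cases : Dec (z ≡ x) → Dec (z ≡ σ ⟨$⟩ˡ x) → SameCycle σ z (detach ⟨$⟩ʳ z)
    by-cases (yes refl) _          = 0 , sym detach-fixes
    by-cases (no _)     (yes refl) = 2 , trans (cong (σ ⟨$⟩ʳ_) (inverseʳ σ)) (sym detach-pred)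
    by-cases (no z≢x)   (no z≢w)   = 1 , sym (detach-other z≢x z≢w)

  detach-SameCycle⇒ : ∀ {z v} → SameCycle detach z v → SameCycle σ z v
  detach-SameCycle⇒ {z} (l , refl) = along l
    where
    along : ∀ l → SameCycle σ z (iterate detach l z)
    along zero    = SameCycle-refl σ z
    along (suc l) = SameCycle-trans σ (along l) (detach-step-SameCycle (iterate detach l z))

  module _ (x-moved : σ ⟨$⟩ʳ x ≢ x) where

    private
      x≢pred : x ≢ σ ⟨$⟩ˡ x
      x≢pred x≡w = x-moved (trans (cong (σ ⟨$⟩ʳ_) x≡w) (inverseʳ σ))

    inversionParity-detach : inversionParity detach ≡ not (inversionParity σ)
    inversionParity-detach =
      trans (inversionParity-∘ₚ (transpose x (σ ⟨$⟩ˡ x)) σ)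
            (cong (_xor inversionParity σ) (inversionParity-transpose x (σ ⟨$⟩ˡ x) x≢pred))

    moved-detach : moved detach < moved σ
    moved-detach = moved-< {σ = σ} {ρ = detach} x fixes detach-fixes x-moved
      where
      fixes : ∀ z → σ ⟨$⟩ʳ z ≡ z → detach ⟨$⟩ʳ z ≡ z
      fixes z σz≡z = trans (detach-other z≢x z≢w) σz≡z
        where
        z≢x : z ≢ x
        z≢x z≡x = x-moved (subst (λ u → σ ⟨$⟩ʳ u ≡ u) z≡x σz≡z)
        z≢w : z ≢ σ ⟨$⟩ˡ x
        z≢w z≡w = x≢pred (trans (sym (inverseʳ σ)) (trans (cong (σ ⟨$⟩ʳ_) (sym z≡w)) (trans σz≡z z≡w)))

    SameCycle⇒detach : ∀ {z v} → z ≢ x → v ≢ x → SameCycle σ z v → SameCycle detach z v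
    SameCycle⇒detach {v = v} z≢x v≢x (l , eq) = from l z≢x eq
      where
      mutual
        from : ∀ l {z} → z ≢ x → iterate σ l z ≡ v → SameCycle detach z v
        from zero    _   eq = 0 , eq
        from (suc l) {z} z≢x eq with σ ⟨$⟩ʳ z ≟ x
        ... | no σz≢x = SameCycle-trans detach (1 , detach-other z≢x (σz≢x ∘ z≡w⇒σz≡x))
                          (from l σz≢x (trans (sym (iterate-sucʳ σ l z)) eq))
          where
          z≡w⇒σz≡x : z ≡ σ ⟨$⟩ˡ x → σ ⟨$⟩ʳ z ≡ x
          z≡w⇒σz≡x z≡w = trans (cong (σ ⟨$⟩ʳ_) z≡w) (inverseʳ σ)
        ... | yes σz≡x = SameCycle-trans detach (1 , trans (cong (detach ⟨$⟩ʳ_) z≡w) detach-pred)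
                          (from-succ l (trans (cong (iterate σ l) (sym σz≡x)) (trans (sym (iterate-sucʳ σ l z)) eq)))
          where
          z≡w : z ≡ σ ⟨$⟩ˡ x
          z≡w = trans (sym (inverseˡ σ)) (cong (σ ⟨$⟩ˡ_) σz≡x)

        from-succ : ∀ l → iterate σ l x ≡ v → SameCycle detach (σ ⟨$⟩ʳ x) v
        from-succ zero    eq = ⊥-elim (v≢x (sym eq))
        from-succ (suc l) eq = from l x-moved (trans (sym (iterate-sucʳ σ l x)) eq)

record IsCycleTransversal (σ : Permutation′ N) (m : Fin N → Bool) : Set where
  field
    marked⇒moved      : ∀ {y} → m y ≡ true → σ ⟨$⟩ʳ y ≢ y
    moved⇒marked      : ∀ {z} → σ ⟨$⟩ʳ z ≢ z → ∃ λ y → m y ≡ true × SameCycle σ z y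
    marked-SameCycle⇒≡ : ∀ {y z} → m y ≡ true → m z ≡ true → SameCycle σ y z → y ≡ z

  marked⇒≢ : ∀ {y z} → m y ≡ true → m z ≡ false → y ≢ z
  marked⇒≢ my mz refl with trans (sym my) mz
  ... | ()

  fixed⇒unmarked : ∀ {z} → σ ⟨$⟩ʳ z ≡ z → m z ≡ false
  fixed⇒unmarked {z} σz≡z with m z in mz
  ... | true  = ⊥-elim (marked⇒moved mz σz≡z)
  ... | false = refl

  unmarked-moved-point : (∀ z → σ ⟨$⟩ʳ z ≡ z) ⊎ ∃ λ x → m x ≡ false × σ ⟨$⟩ʳ x ≢ x
  unmarked-moved-point with Fin.any? (λ z → ¬? (σ ⟨$⟩ʳ z ≟ z))
  ... | no none        = inj₁ λ z → decidable-stable (σ ⟨$⟩ʳ z ≟ z) (λ σz≢z → none (z , σz≢z))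
  ... | yes (z , σz≢z) with m z in mz
  ...   | false = inj₂ (z , mz , σz≢z)
  ...   | true  = inj₂ (σ ⟨$⟩ʳ z , successor-unmarked , σz≢z ∘ ⟨$⟩ʳ-injective σ)
    where
    successor-unmarked : m (σ ⟨$⟩ʳ z) ≡ false
    successor-unmarked with m (σ ⟨$⟩ʳ z) in mσz
    ... | true  = ⊥-elim (σz≢z (sym (marked-SameCycle⇒≡ mz mσz (SameCycle-step σ z))))
    ... | false = refl

SameCycle-2-cycle : (σ : Permutation′ N) {x v : Fin N} → σ ⟨$⟩ʳ (σ ⟨$⟩ʳ x) ≡ x →
  SameCycle σ x v → v ≡ x ⊎ v ≡ σ ⟨$⟩ʳ x
SameCycle-2-cycle σ {x} σ²x≡x (l , refl) = along l
  where
  along : ∀ l → iterate σ l x ≡ x ⊎ iterate σ l x ≡ σ ⟨$⟩ʳ x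
  along zero = inj₁ refl
  along (suc l) with along l
  ... | inj₁ eq = inj₂ (cong (σ ⟨$⟩ʳ_) eq)
  ... | inj₂ eq = inj₁ (trans (cong (σ ⟨$⟩ʳ_) eq) σ²x≡x)

module _ {σ : Permutation′ N} {m : Fin N → Bool} (T : IsCycleTransversal σ m)
         {x : Fin N} (x-unmarked : m x ≡ false) (x-moved : σ ⟨$⟩ʳ x ≢ x) where
  open IsCycleTransversal T

  private
    σ′ : Permutation′ N
    σ′ = detach σ x

    w : Fin N
    w = σ ⟨$⟩ˡ x

    w-moved : σ ⟨$⟩ʳ w ≢ w
    w-moved σw≡w = x-moved (trans (cong (σ ⟨$⟩ʳ_) (sym w≡x)) (inverseʳ σ))
      where
      w≡x : w ≡ x
      w≡x = trans (sym σw≡w) (inverseʳ σ)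

    marked⇒≢x : ∀ {z} → m z ≡ true → z ≢ x
    marked⇒≢x mz = marked⇒≢ mz x-unmarked

    moved-back : ∀ {z} → σ′ ⟨$⟩ʳ z ≢ z → z ≢ x × σ ⟨$⟩ʳ z ≢ z
    moved-back {z} σ′z≢z = z≢x , λ σz≡z → by-cases (z ≟ w) σz≡z
      where
      z≢x : z ≢ x
      z≢x z≡x = σ′z≢z (subst (λ u → σ′ ⟨$⟩ʳ u ≡ u) (sym z≡x) (detach-fixes σ x))
      by-cases : Dec (z ≡ w) → σ ⟨$⟩ʳ z ≢ z
      by-cases (yes refl) = w-moved
      by-cases (no z≢w)   = σ′z≢z ∘ trans (detach-other σ x z≢x z≢w)

    AgreesOff : (Fin N → Bool) → Set
    AgreesOff m′ = ∀ z → z ≢ x → isMoved σ′ z xor m′ z ≡ isMoved σ z xor m z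

    module _ (σx≢w : σ ⟨$⟩ʳ x ≢ w) where

      σ′-moves-w : σ′ ⟨$⟩ʳ w ≢ w
      σ′-moves-w = σx≢w ∘ trans (sym (detach-pred σ x))

      σ′-moves : ∀ {z} → z ≢ x → σ ⟨$⟩ʳ z ≢ z → σ′ ⟨$⟩ʳ z ≢ z
      σ′-moves {z} z≢x σz≢z = by-cases (z ≟ w)
        where
        by-cases : Dec (z ≡ w) → σ′ ⟨$⟩ʳ z ≢ z
        by-cases (yes refl) = σ′-moves-w
        by-cases (no z≢w)   = σz≢z ∘ trans (sym (detach-other σ x z≢x z≢w))

      same-isMoved : ∀ z → z ≢ x → isMoved σ′ z ≡ isMoved σ z
      same-isMoved z z≢x = by-cases (z ≟ w)
        where
        by-cases : Dec (z ≡ w) → isMoved σ′ z ≡ isMoved σ z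
        by-cases (yes refl) = trans (isMoved-true σ′ σ′-moves-w) (sym (isMoved-true σ w-moved))
        by-cases (no z≢w)   = isMoved-cong σ′ σ (detach-other σ x z≢x z≢w)

      moved⇒marked-long : ∀ {z} → σ′ ⟨$⟩ʳ z ≢ z → ∃ λ v → m v ≡ true × SameCycle σ′ z v
      moved⇒marked-long σ′z≢z with moved-back σ′z≢z
      ... | z≢x , σz≢z with moved⇒marked σz≢z
      ...   | v , mv , z∼v = v , mv , SameCycle⇒detach σ x x-moved z≢x (marked⇒≢x mv) z∼v

      long-cycle : IsCycleTransversal σ′ m × AgreesOff m
      long-cycle = record
        { marked⇒moved       = λ mz → σ′-moves (marked⇒≢x mz) (marked⇒moved mz)
        ; moved⇒marked       = moved⇒marked-long
        ; marked-SameCycle⇒≡ = λ my mz → marked-SameCycle⇒≡ my mz ∘ detach-SameCycle⇒ σ x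
        } , λ z z≢x → cong (_xor m z) (same-isMoved z z≢x)

    unmark : Fin N → Fin N → Bool
    unmark y z = m z ∧ not (does (z ≟ y))

    module _ (σx≡w : σ ⟨$⟩ʳ x ≡ w) where

      y : Fin N
      y = σ ⟨$⟩ʳ x

      m′ : Fin N → Bool
      m′ = unmark y

      σy≡x : σ ⟨$⟩ʳ y ≡ x
      σy≡x = trans (cong (σ ⟨$⟩ʳ_) σx≡w) (inverseʳ σ)

      σy≢y : σ ⟨$⟩ʳ y ≢ y
      σy≢y σy≡y = x-moved (trans (sym σy≡y) σy≡x)

      σ′y≡y : σ′ ⟨$⟩ʳ y ≡ y
      σ′y≡y = trans (cong (σ′ ⟨$⟩ʳ_) σx≡w) (detach-pred σ x)

      y-marked : m y ≡ true
      y-marked with moved⇒marked x-moved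
      ... | v , mv , x∼v with SameCycle-2-cycle σ σy≡x x∼v
      ...   | inj₁ v≡x = ⊥-elim (marked⇒≢x mv v≡x)
      ...   | inj₂ v≡y = subst (λ u → m u ≡ true) v≡y mv

      m′-y : m′ y ≡ false
      m′-y = trans (cong (λ b → m y ∧ not b) (dec-true (y ≟ y) refl)) (∧-zeroʳ (m y))

      m′-off : ∀ {z} → z ≢ y → m′ z ≡ m z
      m′-off {z} z≢y = trans (cong (λ b → m z ∧ not b) (dec-false (z ≟ y) z≢y)) (∧-identityʳ (m z))

      m′⇒m : ∀ {z} → m′ z ≡ true → m z ≡ true
      m′⇒m {z} = ∧-trueˡ (m z) _
        where
        ∧-trueˡ : ∀ a b → a ∧ b ≡ true → a ≡ true
        ∧-trueˡ true _ _ = refl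

      m′⇒≢w : ∀ {z} → m′ z ≡ true → z ≢ w
      m′⇒≢w m′z z≡w with trans (sym m′z) (subst (λ u → m′ u ≡ false) (trans σx≡w (sym z≡w)) m′-y)
      ... | ()

      m′-moved : ∀ {z} → m′ z ≡ true → σ′ ⟨$⟩ʳ z ≢ z
      m′-moved m′z = marked⇒moved (m′⇒m m′z) ∘ trans (sym (detach-other σ x (marked⇒≢x (m′⇒m m′z)) (m′⇒≢w m′z)))

      moved⇒marked-two : ∀ {z} → σ′ ⟨$⟩ʳ z ≢ z → ∃ λ v → m′ v ≡ true × SameCycle σ′ z v
      moved⇒marked-two {z} σ′z≢z with moved-back σ′z≢z
      ... | z≢x , σz≢z with moved⇒marked σz≢z
      ...   | v , mv , z∼v = v , trans (m′-off v≢y) mv , SameCycle⇒detach σ x x-moved z≢x (marked⇒≢x mv) z∼v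
        where
        v≢y : v ≢ y
        v≢y refl with SameCycle-2-cycle σ σy≡x (SameCycle-trans σ (SameCycle-step σ x) (SameCycle-sym σ z∼v))
        ... | inj₁ z≡x = z≢x z≡x
        ... | inj₂ z≡y = σ′z≢z (subst (λ u → σ′ ⟨$⟩ʳ u ≡ u) (sym z≡y) σ′y≡y)

      agree : AgreesOff m′
      agree z z≢x = by-cases (z ≟ y)
        where
        by-cases : Dec (z ≡ y) → isMoved σ′ z xor m′ z ≡ isMoved σ z xor m z
        by-cases (yes refl) = trans (cong₂ _xor_ (isMoved-false σ′ σ′y≡y) m′-y)
                                    (sym (cong₂ _xor_ (isMoved-true σ σy≢y) y-marked))
        by-cases (no z≢y)   = cong₂ _xor_ (isMoved-cong σ′ σ (detach-other σ x z≢x (z≢y ∘ λ z≡w → trans z≡w (sym σx≡w))))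
                                          (m′-off z≢y)

      two-cycle : IsCycleTransversal σ′ m′ × AgreesOff m′
      two-cycle = record
        { marked⇒moved       = m′-moved
        ; moved⇒marked       = moved⇒marked-two
        ; marked-SameCycle⇒≡ = λ my mz → marked-SameCycle⇒≡ (m′⇒m my) (m′⇒m mz) ∘ detach-SameCycle⇒ σ x
        } , agree

  detach-transversal : ∃ λ m′ → IsCycleTransversal (detach σ x) m′ ×
    (∀ z → z ≢ x → isMoved (detach σ x) z xor m′ z ≡ isMoved σ z xor m z)
  detach-transversal with σ ⟨$⟩ʳ x ≟ σ ⟨$⟩ˡ x
  ... | no  σx≢w = m , long-cycle σx≢w
  ... | yes σx≡w = unmark (σ ⟨$⟩ʳ x) , two-cycle σx≡w

inversionParity-id : {σ : Permutation′ N} → (∀ z → σ ⟨$⟩ʳ z ≡ z) → inversionParity σ ≡ false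
inversionParity-id σ≗id = ∑-false _ λ i → ∑-false _ λ j →
  trans (cong₂ (λ u v → i <ᵇ j ∧ u <ᵇ v) (σ≗id j) (σ≗id i)) (<ᵇ-asym i j)

inversionParity-transversal : {σ : Permutation′ N} {m : Fin N → Bool} → IsCycleTransversal σ m →
  inversionParity σ ≡ (∑[ x < N ] isMoved σ x) xor (∑[ x < N ] m x)
inversionParity-transversal {N} {σ} {m} T =
  trans (by-size σ m T (<-wellFounded (moved σ))) (∑-distrib-+ (isMoved σ) m)
  where
  by-size : ∀ σ m → IsCycleTransversal σ m → Acc _<_ (moved σ) →
    inversionParity σ ≡ ∑[ x < N ] (isMoved σ x xor m x)
  by-size σ m T (acc smaller) with IsCycleTransversal.unmarked-moved-point T
  ... | inj₁ σ≗id = trans (inversionParity-id {σ = σ} σ≗id)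
        (sym (∑-false _ λ z → cong₂ _xor_ (isMoved-false σ (σ≗id z)) (IsCycleTransversal.fixed⇒unmarked T (σ≗id z))))
  ... | inj₂ (x , mx , x-moved) with detach-transversal T mx x-moved
  ...   | m′ , T′ , agree = begin
    inversionParity σ                                  ≡⟨ not-involutive _ ⟨
    not (not (inversionParity σ))                      ≡⟨ cong not (inversionParity-detach σ x x-moved) ⟨
    not (inversionParity σ′)                           ≡⟨ cong not (by-size σ′ m′ T′ (smaller (moved-detach σ x x-moved))) ⟩
    not (∑[ z < N ] (isMoved σ′ z xor m′ z))           ≡⟨ cong (λ b → b xor ∑[ z < N ] (isMoved σ′ z xor m′ z)) at-x ⟨
    ((isMoved σ x xor m x) xor (isMoved σ′ x xor m′ x)) xor ∑[ z < N ] (isMoved σ′ z xor m′ z)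
                                                       ≡⟨ ∑-agree-off _ _ x (λ z z≢x → sym (agree z z≢x)) ⟨
    ∑[ z < N ] (isMoved σ z xor m z)                   ∎
    where
    open ≡-Reasoning
    σ′ : Permutation′ N
    σ′ = detach σ x
    σ′x≡x : σ′ ⟨$⟩ʳ x ≡ x
    σ′x≡x = detach-fixes σ x
    at-x : (isMoved σ x xor m x) xor (isMoved σ′ x xor m′ x) ≡ true
    at-x rewrite isMoved-true σ x-moved | mx | isMoved-false σ′ σ′x≡x
               | IsCycleTransversal.fixed⇒unmarked T′ σ′x≡x = refl

module _ {n k : ℕ} (G : SimpleGraph n) (s t : Fin k → Fin n) where
  open H n k (proj₁ G) s t

  iter≡iterate : ∀ π l x → iter π l x ≡ iterate π l x
  iter≡iterate π zero    x = refl
  iter≡iterate π (suc l) x = cong (π ⟨$⟩ʳ_) (iter≡iterate π l x)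

  special-sH : ∀ i → Special (sH i)
  special-sH i rewrite Fin.splitAt-↑ˡ n (s i) k = i , inj₁ refl

  sH≢rH : ∀ i j → sH i ≢ rH j
  sH≢rH i j eq with trans (sym (Fin.splitAt-↑ˡ n (s i) k)) (trans (cong (splitAt n) eq) (Fin.splitAt-↑ʳ n k j))
  ... | ()

  loop-arc : ∀ {z} → NonSpecial z → Arc z z
  loop-arc {z} z-nonspecial with splitAt n z
  ... | inj₁ u = loop z-nonspecial
  ... | inj₂ _ = ⊥-elim (z-nonspecial tt)

  DemandCycle-special : ∀ {σ i v} → DemandCycle σ i → SameCycle σ (sH i) v → Special v →
    v ≡ sH i ⊎ v ≡ tH i ⊎ v ≡ rH i
  DemandCycle-special {σ} {i} (m , _ , reach-t , inner , σt≡r , σr≡s) (l , refl) v-special =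
    subst (λ u → u ≡ sH i ⊎ u ≡ tH i ⊎ u ≡ rH i) (iterate-mod σ period l)
      (classify (l % suc (suc m)) (m%n<n l (suc (suc m))) (subst Special (sym (iterate-mod σ period l)) v-special))
    where
    reach-t′ : iterate σ m (sH i) ≡ tH i
    reach-t′ = trans (sym (iter≡iterate σ m (sH i))) reach-t

    period : iterate σ (suc (suc m)) (sH i) ≡ sH i
    period = trans (cong (σ ⟨$⟩ʳ_) (trans (cong (σ ⟨$⟩ʳ_) reach-t′) σt≡r)) σr≡s

    classify : ∀ p → p < suc (suc m) → Special (iterate σ p (sH i)) →
      iterate σ p (sH i) ≡ sH i ⊎ iterate σ p (sH i) ≡ tH i ⊎ iterate σ p (sH i) ≡ rH i
    classify zero    _     _       = inj₁ refl
    classify (suc p) p<2+m special with ℕ.<-cmp (suc p) m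
    ... | tri< p<m _ _ = ⊥-elim (inner (suc p) (ℕ.s≤s z≤n) p<m (subst Special (sym (iter≡iterate σ (suc p) (sH i))) special))
    ... | tri≈ _ refl _ = inj₂ (inj₁ reach-t′)
    ... | tri> _ _ m<p with ℕ.≤-antisym (ℕ.≤-pred p<2+m) m<p
    ...   | refl = inj₂ (inj₂ (trans (cong (σ ⟨$⟩ʳ_) reach-t′) σt≡r))

  DemandCycle-transfer : ∀ {σ τ i} → (∀ l → iterate τ l (sH i) ≡ iterate σ l (sH i)) →
    DemandCycle σ i → DemandCycle τ i
  DemandCycle-transfer {σ} {τ} {i} same (m , 1≤m , reach-t , inner , σt≡r , σr≡s) =
    m , 1≤m , trans (iter-same m) reach-t , (λ l 1≤l l<m → subst NonSpecial (sym (iter-same l)) (inner l 1≤l l<m)) ,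
    τt≡r , τr≡s
    where
    open ≡-Reasoning
    iter-same : ∀ l → iter τ l (sH i) ≡ iter σ l (sH i)
    iter-same l = trans (iter≡iterate τ l _) (trans (same l) (sym (iter≡iterate σ l _)))

    τt≡r : τ ⟨$⟩ʳ tH i ≡ rH i
    τt≡r = begin
      τ ⟨$⟩ʳ tH i                 ≡⟨ cong (τ ⟨$⟩ʳ_) (trans (iter-same m) reach-t) ⟨
      iter τ (suc m) (sH i)       ≡⟨ iter-same (suc m) ⟩
      σ ⟨$⟩ʳ iter σ m (sH i)      ≡⟨ cong (σ ⟨$⟩ʳ_) reach-t ⟩
      σ ⟨$⟩ʳ tH i                 ≡⟨ σt≡r ⟩
      rH i                        ∎

    τr≡s : τ ⟨$⟩ʳ rH i ≡ sH i
    τr≡s = begin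
      τ ⟨$⟩ʳ rH i                 ≡⟨ cong (τ ⟨$⟩ʳ_) (trans (cong (τ ⟨$⟩ʳ_) (trans (iter-same m) reach-t)) τt≡r) ⟨
      iter τ (suc (suc m)) (sH i) ≡⟨ iter-same (suc (suc m)) ⟩
      σ ⟨$⟩ʳ (σ ⟨$⟩ʳ iter σ m (sH i)) ≡⟨ cong (λ u → σ ⟨$⟩ʳ (σ ⟨$⟩ʳ u)) reach-t ⟩
      σ ⟨$⟩ʳ (σ ⟨$⟩ʳ tH i)        ≡⟨ cong (σ ⟨$⟩ʳ_) σt≡r ⟩
      σ ⟨$⟩ʳ rH i                 ≡⟨ σr≡s ⟩
      sH i                        ∎

  isSource : Fin (n + k) → Bool
  isSource v = does (Fin.any? λ j → v ≟ sH j)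

  isSource-sH : ∀ j → isSource (sH j) ≡ true
  isSource-sH j = dec-true (Fin.any? λ j′ → sH j ≟ sH j′) (j , refl)

  isSource⇒sH : ∀ {v} → isSource v ≡ true → ∃ λ j → v ≡ sH j
  isSource⇒sH {v} v-source with Fin.any? (λ j → v ≟ sH j)
  ... | yes found = found

  module _ (disjoint : DisjointPairs n k s t) where

    sH-injective : ∀ {i j} → sH i ≡ sH j → i ≡ j
    sH-injective {i} {j} eq = proj₁ disjoint i j (Fin.↑ˡ-injective k (s i) (s j) eq)

    sH≢tH : ∀ i j → sH i ≢ tH j
    sH≢tH i j eq = proj₂ (proj₂ disjoint) i j (Fin.↑ˡ-injective k (s i) (t j) eq)

    DemandCycle-source : ∀ {σ i j} → DemandCycle σ i → SameCycle σ (sH i) (sH j) → j ≡ i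
    DemandCycle-source {i = i} {j} dc c with DemandCycle-special dc c (special-sH j)
    ... | inj₁ eq        = sH-injective eq
    ... | inj₂ (inj₁ eq) = ⊥-elim (sH≢tH j i eq)
    ... | inj₂ (inj₂ eq) = ⊥-elim (sH≢rH j i eq)

    Good⇒DemandCycle : ∀ {σ} → Good σ → ∀ i → DemandCycle σ i
    Good⇒DemandCycle {σ} good i with proj₂ good (sH i) (special-sH i)
    ... | i′ , (l , eq) , dc′ =
      subst (DemandCycle σ) (sym (DemandCycle-source dc′ (l , trans (sym (iter≡iterate σ l (sH i′))) eq))) dc′

    ShortestGood⇒source-on-cycle : ∀ {σ} → ShortestGood σ → ∀ {x} → σ ⟨$⟩ʳ x ≢ x → ∃ λ j → SameCycle σ x (sH j)
    ShortestGood⇒source-on-cycle {σ} (good , minimal) {x} x-moved with Fin.any? (λ j → sameCycle? σ x (sH j))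
    ... | yes found = found
    ... | no none   = ⊥-elim (ℕ.<-irrefl refl (ℕ.<-≤-trans (moved-fixCycle σ x x-moved) (minimal τ good-τ)))
      where
      τ : Permutation′ (n + k)
      τ = fixCycle σ x

      off-sources : ∀ j → ¬ SameCycle σ x (sH j)
      off-sources j x∼sj = none (j , x∼sj)

      special⇒off : ∀ {z} → Special z → ¬ SameCycle σ x z
      special⇒off {z} z-special x∼z with proj₂ good z z-special
      ... | i , (l , eq) , _ = off-sources i (SameCycle-trans σ x∼z (SameCycle-sym σ (l , trans (sym (iter≡iterate σ l (sH i))) eq)))

      cover : CycleCover τ
      cover z = by-cases (sameCycle? σ x z)
        where
        by-cases : Dec (SameCycle σ x z) → Arc z (τ ⟨$⟩ʳ z)
        by-cases (yes x∼z) = subst (Arc z) (sym (fixCycle-on σ x x∼z)) (loop-arc (λ z-special → special⇒off z-special x∼z))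
        by-cases (no ¬x∼z) = subst (Arc z) (sym (fixCycle-off σ x ¬x∼z)) (proj₁ good z)

      good-τ : Good τ
      good-τ = cover , λ z z-special → demand (proj₂ good z z-special)
        where
        demand : ∀ {z} → (∃ λ i → (∃ λ l → iter σ l (sH i) ≡ z) × DemandCycle σ i) →
                          ∃ λ i → (∃ λ l → iter τ l (sH i) ≡ z) × DemandCycle τ i
        demand (i , (l , eq) , dc) =
          i , (l , trans (iter≡iterate τ l _) (trans (iterate-fixCycle σ x (off-sources i) l) (trans (sym (iter≡iterate σ l _)) eq))) ,
          DemandCycle-transfer (iterate-fixCycle σ x (off-sources i)) dc

    sources-transversal : ∀ {σ} → ShortestGood σ → IsCycleTransversal σ isSource
    sources-transversal {σ} shortest = record
      { marked⇒moved      = λ y-source → source-moved (isSource⇒sH y-source)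
      ; moved⇒marked      = λ z-moved → let (j , z∼sj) = ShortestGood⇒source-on-cycle shortest z-moved
                                         in sH j , isSource-sH j , z∼sj
      ; marked-SameCycle⇒≡ = λ y-source z-source → unique (isSource⇒sH y-source) (isSource⇒sH z-source)
      }
      where
      demand : ∀ i → DemandCycle σ i
      demand = Good⇒DemandCycle (proj₁ shortest)

      source-moved : ∀ {y} → (∃ λ j → y ≡ sH j) → σ ⟨$⟩ʳ y ≢ y
      source-moved (j , refl) σsj≡sj with demand j
      ... | m , _ , reach-t , _ =
        sH≢tH j j (trans (sym (iterate-fixed σ σsj≡sj m)) (trans (sym (iter≡iterate σ m (sH j))) reach-t))

      unique : ∀ {y z} → (∃ λ i → y ≡ sH i) → (∃ λ j → z ≡ sH j) → SameCycle σ y z → y ≡ z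
      unique (i , refl) (j , refl) si∼sj = cong sH (sym (DemandCycle-source (demand i) si∼sj))

    isOdd-inversions-shortest : ∀ {σ} → ShortestGood σ → isOdd (inversions σ) ≡ isOdd (len σ) xor ∑[ v < n + k ] isSource v
    isOdd-inversions-shortest {σ} shortest = begin
      isOdd (inversions σ)                                               ≡⟨ isOdd-inversions σ ⟩
      inversionParity σ                                                  ≡⟨ inversionParity-transversal (sources-transversal shortest) ⟩
      (∑[ v < n + k ] isMoved σ v) xor (∑[ v < n + k ] isSource v)       ≡⟨ cong (_xor ∑[ v < n + k ] isSource v) (isOdd-moved σ) ⟨
      isOdd (len σ) xor ∑[ v < n + k ] isSource v                        ∎
      where open ≡-Reasoning

lemma4 : (n k : ℕ) (G : SimpleGraph n) (s t : Fin k → Fin n) →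
    DisjointPairs n k s t →
    (σ τ : Permutation′ (n + k)) →
    H.ShortestGood n k (proj₁ G) s t σ →
    H.ShortestGood n k (proj₁ G) s t τ →
    sign σ ≡ sign τ
lemma4 n k G s t disjoint σ τ σ-shortest τ-shortest = begin
  sign σ                                   ≡⟨ %2-isOdd (inversions σ) ⟩
  (if isOdd (inversions σ) then 1 else 0)  ≡⟨ cong (if_then 1 else 0) same-parity ⟩
  (if isOdd (inversions τ) then 1 else 0)  ≡⟨ %2-isOdd (inversions τ) ⟨
  sign τ                                   ∎
  where
  open ≡-Reasoning
  open H n k (proj₁ G) s t using (len)

  same-length : len σ ≡ len τ
  same-length = ℕ.≤-antisym (proj₂ σ-shortest τ (proj₁ τ-shortest)) (proj₂ τ-shortest σ (proj₁ σ-shortest))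

  same-parity : isOdd (inversions σ) ≡ isOdd (inversions τ)
  same-parity = trans (isOdd-inversions-shortest G s t disjoint σ-shortest)
                      (trans (cong (λ l → isOdd l xor ∑[ v < n + k ] isSource G s t v) same-length)
                             (sym (isOdd-inversions-shortest G s t disjoint τ-shortest)))
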